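{- For every context $\Gamma$ and formula $A$, the typing $\Gamma\vdash\mathcal{S}(\Gamma\Rightarrow A):A$ holds in $\overline{\lambda}^{co}_{\Sigma}$.
   Context: Formulas are built from atoms by implication $\supset$ (associating to the right); every formula is uniquely $\vec A\supset p=A_1\supset\cdots\supset A_n\supset p$ with $p$ an atom. Contexts are finite lists of declarations $x:A$ with distinct variables. Böhm forests (co-terms of $\overline{\lambda}^{co}_{\Sigma}$) and elimination alternatives are the possibly infinite expressions generated coinductively by $N::=_{co}\lambda x^A.N\mid E_1+\cdots+E_n$ and $E::=_{co}x\langle N_1,\dots,N_k\rangle$ ($n,k\ge0$; the empty sum is written $\mathbb{O}$, a one-element sum $E_1$ is identified with $E_1$, and $+$ is read as associative with neutral element $\mathbb{O}$). Typing in $\overline{\lambda}^{co}_{\Sigma}$ is the greatest relation closed under: from $\Gamma,x:A\vdash N:B$ infer $\Gamma\vdash\lambda x^A.N:A\supset B$; from $(x:B_1\supset\cdots\supset B_k\supset p)\in\Gamma$ and $\Gamma\vdash N_i:B_i$ ($i=1..k$) infer $\Gamma\vdash x\langle N_1,\dots,N_k\rangle:p$; from $\Gamma\vdash E_i:p$ for all $i=1..n$ infer $\Gamma\vdash E_1+\cdots+E_n:p$. The solution space $\mathcal{S}(\Gamma\Rightarrow A)$ is the Böhm forest defined corecursively by $\mathcal{S}(\Gamma\Rightarrow A\supset B)=\lambda x^A.\mathcal{S}(\Gamma,x:A\Rightarrow B)$ ($x$ fresh) and, for an atom $p$, $\mathcal{S}(\Gamma\Rightarrow p)=\sum_{(y:B_1\supset\cdots\supset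 B_k\supset p)\in\Gamma} y\langle\mathcal{S}(\Gamma\Rightarrow B_1),\dots,\mathcal{S}(\Gamma\Rightarrow B_k)\rangle$, the sum ranging over all declarations in $\Gamma$ whose formula ends in the atom $p$. -}

module Defs where

open import Data.Nat using (ℕ; zero; suc; _⊔_; _≟_)
open import Data.Fin using (Fin; cast)
open import Data.List using (List; []; _∷_; map; foldr; length; lookup; filter)
open import Data.List.Membership.Propositional using (_∈_; _∉_)
open import Data.Product using (Σ; Σ-syntax; _×_; _,_; proj₁; proj₂)
open import Data.Unit using (⊤; tt)
open import Data.Container.Core using (Container; _▷_; ⟦_⟧)
open import Relation.Binary.PropositionalEquality using (_≡_)

Atom : Set
Atom = ℕ

Var : Set
Var = ℕ

infixr 6 _⊃_
data Form : Set where
  atom : Atom → Form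
  _⊃_  : Form → Form → Form

_⊃*_ : List Form → Atom → Form
Bs ⊃* p = foldr _⊃_ (atom p) Bs

premises : Form → List Form
premises (atom p) = []
premises (A ⊃ B)  = A ∷ premises B

target : Form → Atom
target (atom p) = p
target (A ⊃ B)  = target B

Ctx : Set
Ctx = List (Var × Form)

dom : Ctx → List Var
dom Γ = map proj₁ Γ

-- Böhm forests (co-terms), as an M-type (final coalgebra).
--   N ::= λ x^A . N  |  E₁ + ⋯ + Eₙ        E ::= x ⟨ N₁ , … , Nₖ ⟩
-- A node is either a λ-abstraction (one child) or a finite sum of
-- elimination alternatives, each given by its head variable and its
-- number k of arguments; the children of a sum node are indexed by
-- (alternative i , argument j).

data Node : Set where
  lam : Var → Form → Node
  sum : List (Var × ℕ) → Node

Children : Node → Set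
Children (lam x A) = ⊤
Children (sum Es)  = Σ[ i ∈ Fin (length Es) ] Fin (proj₂ (lookup Es i))

ForestC : Container _ _
ForestC = Node ▷ Children

-- The forest denoted is the unfolding of
-- the root (its image in the final coalgebra).

record Forest : Set₁ where
  field
    State : Set
    out   : State → ⟦ ForestC ⟧ State
    root  : State
open Forest public

-- Typing in λ̄co_Σ: the greatest relation closed under the rules,
-- i.e. the union of all relations R that are consistent (every
-- triple in R is the conclusion of a rule whose premises are in R).
-- Relations are on sub-forests, i.e. on states of the coalgebra.

module Typing (F : Forest) where

  Rel : Set₁
  Rel = Ctx → State F → Form → Set

  AltStep : Rel → Ctx → (x : Var) (k : ℕ) → (Fin k → State F) → Atom → Set
  AltStep R Γ x k Ns p =
    Σ[ Bs ∈ List Form ] Σ[ eq ∈ length Bs ≡ k ]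
      ((x , Bs ⊃* p) ∈ Γ) × (∀ (j : Fin (length Bs)) → R Γ (Ns (cast eq j)) (lookup Bs j))

  NodeStep : Rel → Ctx → (n : Node) → (Children n → State F) → Form → Set
  NodeStep R Γ (lam x A) ch C =
    Σ[ B ∈ Form ] (C ≡ (A ⊃ B)) × (x ∉ dom Γ) × R ((x , A) ∷ Γ) (ch tt) B
  NodeStep R Γ (sum Es) ch C =
    Σ[ p ∈ Atom ] (C ≡ atom p) ×
      (∀ (i : Fin (length Es)) →
         AltStep R Γ (proj₁ (lookup Es i)) (proj₂ (lookup Es i)) (λ j → ch (i , j)) p)

  Step : Rel → Rel
  Step R Γ s C = NodeStep R Γ (proj₁ (out F s)) (proj₂ (out F s)) C

  Consistent : Rel → Set
  Consistent R = ∀ Γ s C → R Γ s C → Step R Γ s C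

infix 4 _⊢_∶_
_⊢_∶_ : Ctx → Forest → Form → Set₁
Γ ⊢ N ∶ A = Σ[ R ∈ Typing.Rel N ] Typing.Consistent N R × R Γ (root N) A

fresh : Ctx → Var
fresh Γ = suc (foldr _⊔_ 0 (dom Γ))

decls : Atom → Ctx → Ctx
decls p Γ = filter (λ d → target (proj₂ d) ≟ p) Γ

alts : Ctx → List (Var × ℕ)
alts Δ = map (λ d → proj₁ d , length (premises (proj₂ d))) Δ

argAt : (Δ : Ctx) (i : Fin (length (alts Δ))) → Fin (proj₂ (lookup (alts Δ) i)) → Form
argAt ((y , B) ∷ Δ) Fin.zero    j = lookup (premises B) j
argAt ((y , B) ∷ Δ) (Fin.suc i) j = argAt Δ i j

solStep : Ctx × Form → ⟦ ForestC ⟧ (Ctx × Form)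
solStep (Γ , A ⊃ B)  = lam (fresh Γ) A , λ _ → ((fresh Γ , A) ∷ Γ) , B
solStep (Γ , atom p) = sum (alts (decls p Γ)) ,
  λ { (i , j) → Γ , argAt (decls p Γ) i j }

𝒮 : Ctx → Form → Forest
𝒮 Γ A = record { State = Ctx × Form ; out = solStep ; root = (Γ , A) }

-- Typing is a greatest fixed point, so it suffices to exhibit a consistent
-- relation containing the root.  Take the relation typing every state
-- (Γ , C) of the solution space by C in Γ, as long as Γ has distinct
-- variables.  A state at C = A ⊃ B unfolds to λx^A with the child state (Γ , x : A ; B),
-- and x = fresh Γ keeps the variables distinct; a state at an atom p unfolds
-- to one alternative y⟨…⟩ per declaration y : B₁ ⊃ ⋯ ⊃ Bₖ ⊃ p of Γ, whose
-- arguments are the states (Γ , Bᵢ), as the application rule demands.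
module Submission where

open import Data.Nat using (_≤_; _⊔_; _≟_)
open import Data.Nat.Properties using (m≤m⊔n; m≤n⇒m≤o⊔n; <-irrefl)
open import Data.Fin using (Fin; zero; suc)
open import Data.Fin.Properties using (cast-is-id)
open import Data.List using (_∷_; map; foldr; length; lookup)
open import Data.List.Membership.Propositional using (_∈_; _∉_)
open import Data.List.Membership.Propositional.Properties using (∈-filter⁻)
open import Data.List.Relation.Unary.Any using (here; there)
open import Data.List.Relation.Unary.All using (All; _∷_; tabulate)
open import Data.List.Relation.Unary.All.Properties using (¬Any⇒All¬)
open import Data.List.Relation.Unary.AllPairs using (_∷_)
open import Data.List.Relation.Unary.Unique.Propositional using (Unique)
open import Data.Product using (proj₁; proj₂; _×_; _,_)
open import Relation.Binary.PropositionalEquality using (_≡_; refl; sym; cong; subst)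

open import Defs

∈⇒≤-foldr-⊔ : ∀ {n ns} → n ∈ ns → n ≤ foldr _⊔_ 0 ns
∈⇒≤-foldr-⊔ {ns = m ∷ ms} (here refl) = m≤m⊔n m _
∈⇒≤-foldr-⊔ {ns = m ∷ ms} (there n∈ms) = m≤n⇒m≤o⊔n m (∈⇒≤-foldr-⊔ n∈ms)

fresh-∉ : ∀ Γ → fresh Γ ∉ dom Γ
fresh-∉ Γ fresh∈ = <-irrefl refl (∈⇒≤-foldr-⊔ fresh∈)

Unique-extend-fresh : ∀ {Γ} A → Unique (dom Γ) → Unique (dom ((fresh Γ , A) ∷ Γ))
Unique-extend-fresh {Γ} A uniq = ¬Any⇒All¬ (dom Γ) (fresh-∉ Γ) ∷ uniq

premises-⊃*-target : ∀ B → premises B ⊃* target B ≡ B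
premises-⊃*-target (atom p) = refl
premises-⊃*-target (A ⊃ B) = cong (A ⊃_) (premises-⊃*-target B)

decls-sound : ∀ p Γ → All (λ d → d ∈ Γ × target (proj₂ d) ≡ p) (decls p Γ)
decls-sound p Γ = tabulate (∈-filter⁻ (λ d → target (proj₂ d) ≟ p))

∈-premises-⊃* : ∀ {Γ : Ctx} {y B p} → (y , B) ∈ Γ → target B ≡ p → (y , premises B ⊃* p) ∈ Γ
∈-premises-⊃* {Γ} {y} {B} y∈Γ refl =
  subst (λ C → (y , C) ∈ Γ) (sym (premises-⊃*-target B)) y∈Γ

-- Only the root of 𝒮 Γ₀ A₀ depends on Γ₀ and A₀, so one relation serves every root.
module SolutionSpaceTyping (Γ₀ : Ctx) (A₀ : Form) where
  open Typing (𝒮 Γ₀ A₀)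

  SelfTyped : Rel
  SelfTyped Γ s C = s ≡ (Γ , C) × Unique (dom Γ)

  alternatives-typed :
    ∀ {Γ p} (Δ : Ctx) → All (λ d → d ∈ Γ × target (proj₂ d) ≡ p) Δ → Unique (dom Γ) →
    ∀ (i : Fin (length (alts Δ))) →
      AltStep SelfTyped Γ (proj₁ (lookup (alts Δ) i)) (proj₂ (lookup (alts Δ) i))
        (λ j → Γ , argAt Δ i j) p
  alternatives-typed {Γ} ((y , B) ∷ Δ) ((y∈Γ , tgt) ∷ _) uniq zero =
    premises B , refl , ∈-premises-⊃* y∈Γ tgt ,
    λ j → cong (λ k → Γ , lookup (premises B) k) (cast-is-id refl j) , uniq
  alternatives-typed (_ ∷ Δ) (_ ∷ sound) uniq (suc i) = alternatives-typed Δ sound uniq i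

  SelfTyped-consistent : Consistent SelfTyped
  SelfTyped-consistent Γ _ (A ⊃ B) (refl , uniq) =
    B , refl , fresh-∉ Γ , refl , Unique-extend-fresh A uniq
  SelfTyped-consistent Γ _ (atom p) (refl , uniq) =
    p , refl , alternatives-typed (decls p Γ) (decls-sound p Γ) uniq

open SolutionSpaceTyping using (SelfTyped; SelfTyped-consistent)

lemma8 : (Γ : Ctx) (A : Form) → Unique (map proj₁ Γ) → Γ ⊢ 𝒮 Γ A ∶ A
lemma8 Γ A uniq = SelfTyped Γ A , SelfTyped-consistent Γ A , refl , uniq
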